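{- Let $p>25$ be a prime and let $A\subseteq \mathbb{Z}_p\setminus\{0\}$ have cardinality $k$ with $10\le k\le 23$. Then there exist two distinct elements $x_1,x_2\in A$ such that $A':=(A\setminus\{x_1,x_2\})\cup\{x_1+x_2\}$ is a subset of $\mathbb{Z}_p\setminus\{0\}$ of size $k-1$ (i.e. $x_1+x_2\neq 0$ and $x_1+x_2\notin A\setminus\{x_1,x_2\}$).
   Context: $\mathbb{Z}_p$ denotes the cyclic group (field) of integers modulo the prime $p$. -}

module Defs where

open import Data.Nat using (ℕ; NonZero; _+_)
open import Data.Nat.DivMod using (_mod_)
open import Data.Fin using (Fin; toℕ)

-- ℤ_p is represented by Fin p (residues 0 … p-1); addition modulo p.
_+ₚ_ : {p : ℕ} .{{_ : NonZero p}} → Fin p → Fin p → Fin p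
_+ₚ_ {p} x y = (toℕ x + toℕ y) mod p

0ₚ : {p : ℕ} .{{_ : NonZero p}} → Fin p
0ₚ {p} = 0 mod p

-- If no pair works, A is closed under sums of distinct elements (unless the sum is 0), and a
-- closed set with at least three elements is all of ℤ_p ∖ {0}, which has p − 1 ≥ 25 > k elements.
-- For the latter, read A as residues in {1, …, p − 1}, let M be its largest element and
-- s = p − M. For y ∈ A below M, M + y wraps around, so y − s ∈ A or y = s; descending gives
-- s ∈ A and 2s ∈ A. Adding s to elements below M stays in A, so every multiple of s up to M
-- lies in A, which forces s ∣ M, hence s ∣ p and s = 1.
module Submission where

open import Defs
open import Data.Nat using (ℕ; NonZero; _<_; _≤_)
open import Data.Nat.Primality using (Prime)
open import Data.Fin using (Fin)
open import Data.Fin.Subset using (Subset; _∈_; _∉_; ∣_∣)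
open import Data.Product using (Σ-syntax; _×_)
open import Relation.Binary.PropositionalEquality using (_≡_; _≢_)

open import Data.Nat using (zero; suc; _+_; _*_; _∸_; z≤n; s≤s; s≤s⁻¹; _%_; _/_; _≟_; _<?_; z<s; >-nonZero; >-nonZero⁻¹)
open import Data.Nat.Properties
open import Data.Nat.DivMod using (m<n⇒m%n≡m; [m+n]%n≡m%n; %-congˡ; m%n<n; m≡m%n+[m/n]*n)
open import Data.Nat.Divisibility using (_∣_; m%n≡0⇒n∣m; ∣m∣n⇒∣m+n; ∣-refl)
open import Data.Nat.Primality using (prime⇒irreducible)
open import Data.Nat.Induction using (<-rec)
open import Data.Fin using (toℕ) renaming (_≟_ to _≟ᶠ_)
open import Data.Fin.Properties using (toℕ-injective; toℕ<n; toℕ-fromℕ<; any?)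
open import Data.Fin.Subset using (⁅_⁆; ∁; _∪_; _⊆_; inside; outside)
open import Data.Fin.Subset.Properties
  using (_∈?_; p⊆q⇒∣p∣≤∣q∣; ∣∁p∣≡n∸∣p∣; ∣⁅x⁆∣≡1; x∈p∪q⁺; x∈⁅x⁆; x∈∁p⇒x∉p; x∉⁅y⁆⇒x≢y)
open import Data.Product using (∃; _,_; proj₁; proj₂; map₂)
open import Data.Sum using (_⊎_; inj₁; inj₂)
open import Data.Vec using ([]; _∷_)
open import Relation.Nullary using (Dec; yes; no; ¬_; _×-dec_; ¬?; contradiction)
open import Relation.Unary using (Decidable)
open import Relation.Binary.PropositionalEquality using (refl; sym; trans; ≢-sym; cong; cong₂; subst; module ≡-Reasoning)
open import Function using (_∘_)

greatest : ∀ {P : ℕ → Set} → Decidable P → ∀ b {a} → P a → a ≤ b →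
           ∃ λ m → P m × (∀ {n} → P n → n ≤ b → n ≤ m)
greatest P? zero    {a} Pa a≤0 = a , Pa , λ _ n≤0 → ≤-trans n≤0 z≤n
greatest {P} P? (suc b) Pa a≤1+b with P? (suc b)
... | yes P[1+b] = suc b , P[1+b] , λ _ n≤1+b → n≤1+b
... | no ¬P[1+b] =
  let m , Pm , m-max = greatest P? b Pa (≤b Pa a≤1+b)
  in  m , Pm , λ Pn n≤1+b → m-max Pn (≤b Pn n≤1+b)
  where
  ≤b : ∀ {n} → P n → n ≤ suc b → n ≤ b
  ≤b Pn n≤1+b = s≤s⁻¹ (≤∧≢⇒< n≤1+b λ { refl → ¬P[1+b] Pn })

∣p∪q∣≤∣p∣+∣q∣ : ∀ {n} (p q : Subset n) → ∣ p ∪ q ∣ ≤ ∣ p ∣ + ∣ q ∣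
∣p∪q∣≤∣p∣+∣q∣ []            []            = z≤n
∣p∪q∣≤∣p∣+∣q∣ (inside  ∷ p) (inside  ∷ q) = s≤s (≤-trans (∣p∪q∣≤∣p∣+∣q∣ p q) (+-monoʳ-≤ ∣ p ∣ (n≤1+n ∣ q ∣)))
∣p∪q∣≤∣p∣+∣q∣ (inside  ∷ p) (outside ∷ q) = s≤s (∣p∪q∣≤∣p∣+∣q∣ p q)
∣p∪q∣≤∣p∣+∣q∣ (outside ∷ p) (inside  ∷ q) = ≤-trans (s≤s (∣p∪q∣≤∣p∣+∣q∣ p q)) (≤-reflexive (sym (+-suc _ _)))
∣p∪q∣≤∣p∣+∣q∣ (outside ∷ p) (outside ∷ q) = ∣p∪q∣≤∣p∣+∣q∣ p q

∃-third : ∀ {n} {A : Subset n} → 3 ≤ ∣ A ∣ → ∀ a b → ∃ λ y → y ∈ A × y ≢ a × y ≢ b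
∃-third {A = A} 3≤∣A∣ a b with any? (λ y → y ∈? A ×-dec ¬? (y ≟ᶠ a) ×-dec ¬? (y ≟ᶠ b))
... | yes found = found
... | no  none  = contradiction (≤-trans (p⊆q⇒∣p∣≤∣q∣ A⊆⁅a⁆∪⁅b⁆) ∣⁅a⁆∪⁅b⁆∣≤2) (<⇒≱ 3≤∣A∣)
  where
  A⊆⁅a⁆∪⁅b⁆ : A ⊆ ⁅ a ⁆ ∪ ⁅ b ⁆
  A⊆⁅a⁆∪⁅b⁆ {x} x∈A with x ≟ᶠ a | x ≟ᶠ b
  ... | yes refl | _        = x∈p∪q⁺ (inj₁ (x∈⁅x⁆ x))
  ... | no _     | yes refl = x∈p∪q⁺ (inj₂ (x∈⁅x⁆ x))
  ... | no x≢a   | no x≢b   = contradiction (x , x∈A , x≢a , x≢b) none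
  ∣⁅a⁆∪⁅b⁆∣≤2 : ∣ ⁅ a ⁆ ∪ ⁅ b ⁆ ∣ ≤ 2
  ∣⁅a⁆∪⁅b⁆∣≤2 = ≤-trans (∣p∪q∣≤∣p∣+∣q∣ ⁅ a ⁆ ⁅ b ⁆) (≤-reflexive (cong₂ _+_ (∣⁅x⁆∣≡1 a) (∣⁅x⁆∣≡1 b)))

module ResidueSet (p : ℕ) .{{_ : NonZero p}} (p-prime : Prime p)
  {S : ℕ → Set} (S? : Decidable S) (inhabited : ∃ S)
  (positive : ∀ {n} → S n → 0 < n)
  (bounded : ∀ {n} → S n → n < p)
  (closed : ∀ {a b} → S a → S b → a ≢ b → (a + b) % p ≡ 0 ⊎ S ((a + b) % p))
  (third : ∀ {a b} → S a → S b → ∃ λ y → S y × y ≢ a × y ≢ b)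
  where

  private
    largest : ∃ λ m → S m × (∀ {n} → S n → n ≤ p → n ≤ m)
    largest = let x , x∈S = inhabited in greatest S? p x∈S (<⇒≤ (bounded x∈S))

  M : ℕ
  M = proj₁ largest

  M∈S : S M
  M∈S = proj₁ (proj₂ largest)

  maximal : ∀ {n} → S n → n ≤ M
  maximal n∈S = proj₂ (proj₂ largest) n∈S (<⇒≤ (bounded n∈S))

  s : ℕ
  s = p ∸ M

  M+s≡p : M + s ≡ p
  M+s≡p = m+[n∸m]≡n (<⇒≤ (bounded M∈S))

  0<s : 0 < s
  0<s = m<n⇒0<n∸m (bounded M∈S)

  instance
    s≢0 : NonZero s
    s≢0 = >-nonZero 0<s

  p≤M+y : ∀ {y} → S y → y < M → p ≤ M + y
  p≤M+y {y} y∈S y<M with M + y <? p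
  ... | no  M+y≮p = ≮⇒≥ M+y≮p
  ... | yes M+y<p with closed M∈S y∈S (≢-sym (<⇒≢ y<M))
  ...   | inj₁ ≡0   = contradiction (trans (sym (m<n⇒m%n≡m M+y<p)) ≡0)
                                    (≢-sym (<⇒≢ (<-≤-trans (positive y∈S) (m≤n+m y M))))
  ...   | inj₂ ∈S   = contradiction (maximal (subst S (m<n⇒m%n≡m M+y<p) ∈S))
                                    (<⇒≱ (m<m+n M (positive y∈S)))

  s≤y : ∀ {y} → S y → y < M → s ≤ y
  s≤y y∈S y<M = +-cancelˡ-≤ M _ _ (≤-trans (≤-reflexive M+s≡p) (p≤M+y y∈S y<M))

  [M+y]%p≡y∸s : ∀ {y} → S y → y < M → (M + y) % p ≡ y ∸ s
  [M+y]%p≡y∸s {y} y∈S y<M = begin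
    (M + y) % p               ≡⟨ %-congˡ (sym (m∸n+n≡m (p≤M+y y∈S y<M))) ⟩
    (M + y ∸ p + p) % p       ≡⟨ [m+n]%n≡m%n (M + y ∸ p) p ⟩
    (M + y ∸ p) % p           ≡⟨ cong (λ t → (M + y ∸ t) % p) (sym M+s≡p) ⟩
    (M + y ∸ (M + s)) % p     ≡⟨ cong (_% p) ([m+n]∸[m+o]≡n∸o M y s) ⟩
    (y ∸ s) % p               ≡⟨ m<n⇒m%n≡m (≤-<-trans (m∸n≤m y s) (bounded y∈S)) ⟩
    y ∸ s                     ∎
    where open ≡-Reasoning

  wrap : ∀ {y} → S y → y < M → y ≡ s ⊎ S (y ∸ s)
  wrap y∈S y<M with closed M∈S y∈S (≢-sym (<⇒≢ y<M))
  ... | inj₁ ≡0 = inj₁ (≤-antisym (m∸n≡0⇒m≤n (trans (sym ([M+y]%p≡y∸s y∈S y<M)) ≡0)) (s≤y y∈S y<M))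
  ... | inj₂ ∈S = inj₂ (subst S ([M+y]%p≡y∸s y∈S y<M) ∈S)

  Descent : ℕ → Set
  Descent y = S y → y < M → S s × (y ≢ s → S (s + s))

  descend : ∀ y → Descent y
  descend = <-rec Descent step
    where
    step : ∀ y → (∀ {z} → z < y → Descent z) → Descent y
    step y rec y∈S y<M with wrap y∈S y<M
    ... | inj₁ y≡s   = subst S y≡s y∈S , λ y≢s → contradiction y≡s y≢s
    ... | inj₂ y∸s∈S with y ∸ s ≟ s
    ...   | yes y∸s≡s = subst S y∸s≡s y∸s∈S
                      , λ _ → subst S (trans (sym (m∸n+n≡m (s≤y y∈S y<M))) (cong (_+ s) y∸s≡s)) y∈S
    ...   | no  y∸s≢s = map₂ (λ 2s∈S _ → 2s∈S y∸s≢s) (rec y∸s<y y∸s∈S (<-trans y∸s<y y<M))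
      where
      y∸s<y : y ∸ s < y
      y∸s<y = ∸-monoʳ-< 0<s (s≤y y∈S y<M)

  below-M : ∀ {y} → S y → y ≢ M → y < M
  below-M y∈S y≢M = ≤∧≢⇒< (maximal y∈S) y≢M

  s∈S : S s
  s∈S = let y , y∈S , y≢M , _ = third M∈S M∈S in proj₁ (descend y y∈S (below-M y∈S y≢M))

  2s∈S : S (s + s)
  2s∈S = let z , z∈S , z≢s , z≢M = third s∈S M∈S in proj₂ (descend z z∈S (below-M z∈S z≢M)) z≢s

  [w+s]%p≡w+s : ∀ {w} → w < M → (w + s) % p ≡ w + s
  [w+s]%p≡w+s w<M = m<n⇒m%n≡m (<-≤-trans (+-monoˡ-< s w<M) (≤-reflexive M+s≡p))

  shift : ∀ {w} → S w → w < M → S (w + s)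
  shift {w} w∈S w<M with w ≟ s
  ... | yes w≡s = subst (λ t → S (t + s)) (sym w≡s) 2s∈S
  ... | no  w≢s with closed w∈S s∈S w≢s
  ...   | inj₁ ≡0 = contradiction (trans (sym ([w+s]%p≡w+s w<M)) ≡0) (≢-sym (<⇒≢ (<-≤-trans 0<s (m≤n+m s w))))
  ...   | inj₂ ∈S = subst S ([w+s]%p≡w+s w<M) ∈S

  multiples : ∀ i → suc i * s ≤ M → S (suc i * s)
  multiples zero    _       = subst S (sym (+-identityʳ s)) s∈S
  multiples (suc i) [2+i]s≤M = subst S (+-comm (suc i * s) s) (shift (multiples i (<⇒≤ [1+i]s<M)) [1+i]s<M)
    where
    [1+i]s<M : suc i * s < M
    [1+i]s<M = <-≤-trans (m<n+m (suc i * s) 0<s) [2+i]s≤M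

  remainder≡0 : ∀ q r → M ≡ r + q * s → r < s → r ≡ 0
  remainder≡0 zero    r         M≡r    r<s =
    contradiction (trans M≡r (+-identityʳ r)) (≢-sym (<⇒≢ (<-≤-trans r<s (maximal s∈S))))
  remainder≡0 (suc q) zero      _       _   = refl
  remainder≡0 (suc q) r@(suc _) M≡r+qs r<s = contradiction s≤r (<⇒≱ r<s)
    where
    qs<M : suc q * s < M
    qs<M = <-≤-trans (m<n+m (suc q * s) {r} z<s) (≤-reflexive (sym M≡r+qs))
    s≤r : s ≤ r
    s≤r = +-cancelˡ-≤ (suc q * s) s r
            (≤-trans (maximal (shift (multiples q (<⇒≤ qs<M)) qs<M)) (≤-reflexive (trans M≡r+qs (+-comm r _))))

  s∣M : s ∣ M
  s∣M = m%n≡0⇒n∣m M s (remainder≡0 (M / s) (M % s) (m≡m%n+[m/n]*n M s) (m%n<n M s))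

  s≡1 : s ≡ 1
  s≡1 with prime⇒irreducible p-prime (subst (s ∣_) M+s≡p (∣m∣n⇒∣m+n s∣M ∣-refl))
  ... | inj₁ s≡1 = s≡1
  ... | inj₂ s≡p = contradiction (trans s≡p (sym M+s≡p)) (<⇒≢ (m<n+m s (positive M∈S)))

  complete : ∀ n → 0 < n → n < p → S n
  complete (suc i) _ 1+i<p = subst S [1+i]s≡1+i (multiples i (≤-trans (≤-reflexive [1+i]s≡1+i) 1+i≤M))
    where
    [1+i]s≡1+i : suc i * s ≡ suc i
    [1+i]s≡1+i = trans (cong (suc i *_) s≡1) (*-identityʳ (suc i))
    1+i≤M : suc i ≤ M
    1+i≤M = s≤s⁻¹ (≤-trans 1+i<p (≤-reflexive (trans (sym M+s≡p) (trans (cong (M +_) s≡1) (+-comm M 1)))))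

SumClosed : ∀ {p} .{{_ : NonZero p}} → Subset p → Set
SumClosed A = ∀ {a b} → a ∈ A → b ∈ A → a ≢ b → a +ₚ b ≡ 0ₚ ⊎ a +ₚ b ∈ A

toℕ-0ₚ : ∀ {p} .{{_ : NonZero p}} → toℕ (0ₚ {p}) ≡ 0
toℕ-0ₚ {p} = trans (toℕ-fromℕ< _) (m<n⇒m%n≡m (>-nonZero⁻¹ p))

toℕ-+ₚ : ∀ {p} .{{_ : NonZero p}} (a b : Fin p) → toℕ (a +ₚ b) ≡ (toℕ a + toℕ b) % p
toℕ-+ₚ a b = toℕ-fromℕ< _

sumClosed⇒∁⁅0⁆⊆ : ∀ {p} .{{_ : NonZero p}} → Prime p → {A : Subset p} →
                  0ₚ ∉ A → 3 ≤ ∣ A ∣ → SumClosed A → ∁ ⁅ 0ₚ ⁆ ⊆ A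
sumClosed⇒∁⁅0⁆⊆ {p} p-prime {A} 0∉A 3≤∣A∣ closed {x} x∈∁⁅0⁆ =
  let i , i≡x , i∈A = complete (toℕ x) 0<x (toℕ<n x) in subst (_∈ A) (toℕ-injective i≡x) i∈A
  where
  Image : ℕ → Set
  Image n = ∃ λ i → toℕ i ≡ n × i ∈ A

  inhabited : ∃ Image
  inhabited = let y , y∈A , _ = ∃-third 3≤∣A∣ 0ₚ 0ₚ in toℕ y , y , refl , y∈A

  positive : ∀ {n} → Image n → 0 < n
  positive (i , refl , i∈A) = n≢0⇒n>0 λ i≡0 → 0∉A (subst (_∈ A) (toℕ-injective (trans i≡0 (sym toℕ-0ₚ))) i∈A)

  bounded : ∀ {n} → Image n → n < p
  bounded (i , refl , _) = toℕ<n i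

  closedℕ : ∀ {a b} → Image a → Image b → a ≢ b → (a + b) % p ≡ 0 ⊎ Image ((a + b) % p)
  closedℕ (i , refl , i∈A) (j , refl , j∈A) i≢j with closed i∈A j∈A (i≢j ∘ cong toℕ)
  ... | inj₁ i+j≡0 = inj₁ (trans (sym (toℕ-+ₚ i j)) (trans (cong toℕ i+j≡0) toℕ-0ₚ))
  ... | inj₂ i+j∈A = inj₂ (i +ₚ j , toℕ-+ₚ i j , i+j∈A)

  third : ∀ {a b} → Image a → Image b → ∃ λ y → Image y × y ≢ a × y ≢ b
  third (i , refl , _) (j , refl , _) =
    let y , y∈A , y≢i , y≢j = ∃-third 3≤∣A∣ i j
    in  toℕ y , (y , refl , y∈A) , y≢i ∘ toℕ-injective , y≢j ∘ toℕ-injective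

  open ResidueSet p p-prime (λ n → any? (λ i → toℕ i ≟ n ×-dec i ∈? A)) inhabited positive bounded closedℕ third
    using (complete)

  0<x : 0 < toℕ x
  0<x = n≢0⇒n>0 λ x≡0 → x∉⁅y⁆⇒x≢y (x∈∁p⇒x∉p x∈∁⁅0⁆) (toℕ-injective (trans x≡0 (sym toℕ-0ₚ)))

sumClosed⇒p∸1≤∣A∣ : ∀ {p} .{{_ : NonZero p}} → Prime p → {A : Subset p} →
                    0ₚ ∉ A → 3 ≤ ∣ A ∣ → SumClosed A → p ∸ 1 ≤ ∣ A ∣
sumClosed⇒p∸1≤∣A∣ {p} p-prime 0∉A 3≤∣A∣ closed = begin
  p ∸ 1            ≡⟨ cong (p ∸_) (∣⁅x⁆∣≡1 0ₚ) ⟨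
  p ∸ ∣ ⁅ 0ₚ ⁆ ∣   ≡⟨ ∣∁p∣≡n∸∣p∣ ⁅ 0ₚ ⁆ ⟨
  ∣ ∁ ⁅ 0ₚ ⁆ ∣     ≤⟨ p⊆q⇒∣p∣≤∣q∣ (sumClosed⇒∁⁅0⁆⊆ p-prime 0∉A 3≤∣A∣ closed) ⟩
  _                ∎
  where open ≤-Reasoning

GoodPair : ∀ {p} .{{_ : NonZero p}} → Subset p → Fin p → Fin p → Set
GoodPair A x₁ x₂ = x₁ ∈ A × x₂ ∈ A × x₁ ≢ x₂ × x₁ +ₚ x₂ ≢ 0ₚ × x₁ +ₚ x₂ ∉ A

goodPair? : ∀ {p} .{{_ : NonZero p}} (A : Subset p) x₁ x₂ → Dec (GoodPair A x₁ x₂)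
goodPair? A x₁ x₂ = x₁ ∈? A ×-dec x₂ ∈? A ×-dec ¬? (x₁ ≟ᶠ x₂) ×-dec ¬? (x₁ +ₚ x₂ ≟ᶠ 0ₚ) ×-dec ¬? (x₁ +ₚ x₂ ∈? A)

noGoodPair⇒sumClosed : ∀ {p} .{{_ : NonZero p}} {A : Subset p} →
                       (∀ x₁ x₂ → ¬ GoodPair A x₁ x₂) → SumClosed A
noGoodPair⇒sumClosed {A = A} none {a} {b} a∈A b∈A a≢b with a +ₚ b ≟ᶠ 0ₚ | a +ₚ b ∈? A
... | yes a+b≡0 | _         = inj₁ a+b≡0
... | no  _     | yes a+b∈A = inj₂ a+b∈A
... | no  a+b≢0 | no  a+b∉A = contradiction (a∈A , b∈A , a≢b , a+b≢0 , a+b∉A) (none a b)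

lemma2p2 : (p : ℕ) .{{_ : NonZero p}} → Prime p → 25 < p →
    (k : ℕ) → 10 ≤ k → k ≤ 23 →
    (A : Subset p) → 0ₚ ∉ A → ∣ A ∣ ≡ k →
    Σ[ x₁ ∈ Fin p ] Σ[ x₂ ∈ Fin p ]
    (x₁ ∈ A × x₂ ∈ A × x₁ ≢ x₂ × (x₁ +ₚ x₂) ≢ 0ₚ ×
    ((y : Fin p) → y ∈ A → y ≢ x₁ → y ≢ x₂ → y ≢ (x₁ +ₚ x₂)))
lemma2p2 p p-prime 25<p k 10≤k k≤23 A 0∉A ∣A∣≡k
  with any? (λ x₁ → any? (goodPair? A x₁))
... | yes (x₁ , x₂ , x₁∈A , x₂∈A , x₁≢x₂ , x₁+x₂≢0 , x₁+x₂∉A) =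
  x₁ , x₂ , x₁∈A , x₂∈A , x₁≢x₂ , x₁+x₂≢0 , λ y y∈A _ _ y≡x₁+x₂ → x₁+x₂∉A (subst (_∈ A) y≡x₁+x₂ y∈A)
... | no noGoodPair = contradiction (≤-trans 25≤p∸1 p∸1≤k) (<⇒≱ (≤-trans (s≤s k≤23) (n≤1+n 24)))
  where
  3≤∣A∣ : 3 ≤ ∣ A ∣
  3≤∣A∣ = subst (3 ≤_) (sym ∣A∣≡k) (≤-trans (m≤m+n 3 7) 10≤k)
  p∸1≤k : p ∸ 1 ≤ k
  p∸1≤k = subst (p ∸ 1 ≤_) ∣A∣≡k
            (sumClosed⇒p∸1≤∣A∣ p-prime 0∉A 3≤∣A∣ (noGoodPair⇒sumClosed λ x₁ x₂ good → noGoodPair (x₁ , x₂ , good)))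
  25≤p∸1 : 25 ≤ p ∸ 1
  25≤p∸1 = ∸-monoˡ-≤ 1 25<p
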